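{- Let $(L,\leq)$ be a finite lower locally distributive lattice, $f:L\to\mathbb{R}$, and let $m:L\to\mathbb{R}$ be the Möbius transform of $f$, i.e. the unique function with $f(x)=\sum_{y\leq x}m(y)$ for all $x\in L$. Let $x\in L$ and let $i\in\mathcal{J}(L)$ be such that the derivative $\Delta_i f(x)$ is Boolean. Then \[\Delta_i f(x)=\sum_{y\in[i,x\vee i]}m(y).\]
   Context: A finite lattice is lower locally distributive if it is lower semi-modular (for all $x,y$, if $x\vee y$ covers both $x$ and $y$ then $x$ and $y$ both cover $x\wedge y$) and contains no sublattice isomorphic to $M_3$. $\mathcal{J}(L)$ denotes the set of join-irreducible elements (non-bottom elements covering exactly one element). For $i\in\mathcal{J}(L)$, $\Delta_i f(x):=f(x\vee i)-f(x)$; this derivative is called Boolean if $x\vee i$ covers $x$ (i.e. $[x,x\vee i]$ is the two-element Boolean lattice). -}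

module Defs where

open import Level using (Level; _⊔_)
open import Data.Product using (Σ; ∃; _×_; _,_)
open import Data.Sum using (_⊎_)
open import Data.List using (List; foldr; filter)
open import Data.List.Membership.Propositional using (_∈_)
open import Data.List.Relation.Unary.Unique.Propositional using (Unique)
open import Relation.Nullary using (¬_; Dec)
open import Relation.Nullary.Decidable using (_×-dec_)
open import Relation.Binary using (Rel; Decidable)
open import Relation.Binary.PropositionalEquality using (_≡_; _≢_)
open import Relation.Binary.Lattice.Structures using (IsLattice)
open import Algebra.Bundles using (AbelianGroup)

record FiniteLattice : Set₁ where
  infixr 6 _∨_
  infixr 7 _∧_
  infix 4 _≤_
  field
    Carrier   : Set
    _≤_       : Rel Carrier Level.zero
    _∨_       : Carrier → Carrier → Carrier
    _∧_       : Carrier → Carrier → Carrier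
    isLattice : IsLattice _≡_ _≤_ _∨_ _∧_
    _≤?_      : Decidable _≤_
    elements  : List Carrier
    complete  : ∀ x → x ∈ elements
    unique    : Unique elements

  _⋖_ : Carrier → Carrier → Set
  x ⋖ y = (x ≤ y) × (x ≢ y) × (∀ z → x ≤ z → z ≤ y → (z ≡ x) ⊎ (z ≡ y))

  LowerSemimodular : Set
  LowerSemimodular = ∀ x y → x ⋖ (x ∨ y) → y ⋖ (x ∨ y) →
                     ((x ∧ y) ⋖ x) × ((x ∧ y) ⋖ y)

  IsM₃ : Carrier → Carrier → Carrier → Carrier → Carrier → Set
  IsM₃ o a b c t =
    (o ≢ a) × (o ≢ b) × (o ≢ c) × (o ≢ t) × (a ≢ b) × (a ≢ c) × (a ≢ t) ×
    (b ≢ c) × (b ≢ t) × (c ≢ t) ×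
    (a ∧ b ≡ o) × (a ∧ c ≡ o) × (b ∧ c ≡ o) ×
    (a ∨ b ≡ t) × (a ∨ c ≡ t) × (b ∨ c ≡ t)

  HasNoM₃ : Set
  HasNoM₃ = ∀ o a b c t → ¬ IsM₃ o a b c t

  LowerLocallyDistributive : Set
  LowerLocallyDistributive = LowerSemimodular × HasNoM₃

  JoinIrreducible : Carrier → Set
  JoinIrreducible j = (∃ λ y → y ⋖ j) × (∀ y z → y ⋖ j → z ⋖ j → y ≡ z)

module _ {c ℓ : Level} (L : FiniteLattice) (G : AbelianGroup c ℓ) where
  open FiniteLattice L
  open AbelianGroup G renaming (Carrier to V)

  sumWhere : {P : Carrier → Set} → (∀ y → Dec (P y)) →
             (Carrier → V) → V
  sumWhere P? m = foldr (λ y acc → m y ∙ acc) ε (filter P? elements)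

  sumBelow : (Carrier → V) → Carrier → V
  sumBelow m x = sumWhere (λ y → y ≤? x) m

  sumInterval : (Carrier → V) → Carrier → Carrier → V
  sumInterval m a b = sumWhere (λ y → (a ≤? y) ×-dec (y ≤? b)) m

  IsMobiusTransform : (Carrier → V) → (Carrier → V) → Set ℓ
  IsMobiusTransform f m = ∀ x → f x ≈ sumBelow m x

  Δ : (Carrier → V) → Carrier → Carrier → V
  Δ f i x = f (x ∨ i) - f x

-- For x ⋖ x ∨ i the down-set of x ∨ i is the disjoint union of ↓x and [i, x ∨ i]
-- (disjoint because i ≰ x), so Δ_i f(x) = Σ_{↓(x ∨ i)} m − Σ_{↓x} m is the sum of m over
-- [i, x ∨ i].  That every y ≤ x ∨ i with y ≰ x lies above i is the lattice-theoretic core.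
-- In a lower locally distributive lattice, the elements below t but not below a lower
-- cover x of t are closed under meets: descending along lower covers with lower
-- semimodularity, a counterexample yields three lower covers of one element spanning an M₃.
-- Likewise x ∧ i is a lower cover of i, hence its unique one as i is join-irreducible;
-- so y ∧ i, which is not below x, cannot lie strictly below i.
module Submission where

open import Defs
open import Level using (Level; 0ℓ)
open import Algebra.Bundles using (AbelianGroup; CommutativeMonoid)
import Algebra.Properties.AbelianGroup as AbelianGroupProperties
import Algebra.Properties.CommutativeSemigroup as CommutativeSemigroupProperties
open import Data.Nat using (ℕ; z≤n; s≤s) renaming (_≤_ to _≤ℕ_; _<_ to _<ℕ_)
open import Data.Nat.Properties using (m≤n⇒m≤1+n)
import Data.Nat.Induction as ℕ
open import Data.Product using (Σ-syntax; _×_; _,_; proj₁; proj₂)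
open import Data.Sum using (_⊎_; inj₁; inj₂)
open import Data.Empty using (⊥-elim)
open import Data.List using (List; []; _∷_; foldr; filter; length)
open import Data.List.Membership.Propositional using (_∈_; lose)
open import Data.List.Relation.Unary.Any using (here; there; any?; satisfied)
open import Function using (flip)
open import Induction.WellFounded using (WellFounded; module Subrelation; module All)
import Relation.Binary.Construct.On as On
open import Relation.Nullary using (¬_; Dec; yes; no; ¬?)
open import Relation.Nullary.Decidable using (_×-dec_)
open import Relation.Unary using (Pred; Decidable)
open import Relation.Binary.Definitions using (DecidableEquality)
open import Relation.Binary.PropositionalEquality as ≡ using (_≡_; _≢_; refl; cong; subst)
open import Relation.Binary.Lattice using (Lattice; IsLattice)
import Relation.Binary.Lattice.Properties.MeetSemilattice as MeetSemilatticeProperties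
import Relation.Binary.Properties.Poset as PosetProperties
import Relation.Binary.Reasoning.Setoid as ≈-Reasoning

module _ {A : Set} {P Q : Pred A 0ℓ} (P? : Decidable P) (Q? : Decidable Q)
         (P⇒Q : ∀ {y} → P y → Q y) where

  length-filter-mono : ∀ xs → length (filter P? xs) ≤ℕ length (filter Q? xs)
  length-filter-mono [] = z≤n
  length-filter-mono (y ∷ xs) with P? y | Q? y
  ... | yes Py | no ¬Qy = ⊥-elim (¬Qy (P⇒Q Py))
  ... | yes _  | yes _  = s≤s (length-filter-mono xs)
  ... | no _   | yes _  = m≤n⇒m≤1+n (length-filter-mono xs)
  ... | no _   | no _   = length-filter-mono xs

  length-filter-< : ∀ {w} xs → w ∈ xs → Q w → ¬ P w →
                    length (filter P? xs) <ℕ length (filter Q? xs)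
  length-filter-< (y ∷ xs) w∈ Qw ¬Pw with P? y | Q? y | w∈
  ... | yes Py | no ¬Qy | _           = ⊥-elim (¬Qy (P⇒Q Py))
  ... | yes Py | yes _  | here refl   = ⊥-elim (¬Pw Py)
  ... | yes _  | yes _  | there w∈xs  = s≤s (length-filter-< xs w∈xs Qw ¬Pw)
  ... | no _   | yes _  | _           = s≤s (length-filter-mono xs)
  ... | no _   | no ¬Qy | here refl   = ⊥-elim (¬Qy Qw)
  ... | no _   | no _   | there w∈xs  = length-filter-< xs w∈xs Qw ¬Pw

module _ {c ℓ : Level} (M : CommutativeMonoid c ℓ) {A : Set}
         (m : A → CommutativeMonoid.Carrier M) where
  open CommutativeMonoid M
  open CommutativeSemigroupProperties commutativeSemigroup using (x∙yz≈y∙xz)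
  open ≈-Reasoning setoid

  sumFilter : {P : Pred A 0ℓ} → Decidable P → List A → Carrier
  sumFilter P? xs = foldr (λ y acc → m y ∙ acc) ε (filter P? xs)

  sumFilter-⊎ : {P Q R : Pred A 0ℓ} (P? : Decidable P) (Q? : Decidable Q) (R? : Decidable R) →
                (∀ {y} → P y → Q y ⊎ R y) → (∀ {y} → Q y → P y) → (∀ {y} → R y → P y) →
                (∀ {y} → Q y → ¬ R y) →
                ∀ xs → sumFilter P? xs ≈ sumFilter Q? xs ∙ sumFilter R? xs
  sumFilter-⊎ P? Q? R? P⇒Q⊎R Q⇒P R⇒P Q⇒¬R = go
    where
    go : ∀ xs → sumFilter P? xs ≈ sumFilter Q? xs ∙ sumFilter R? xs
    go [] = sym (identityˡ ε)
    go (y ∷ xs) with P? y | Q? y | R? y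
    ... | yes _  | yes Qy | yes Ry = ⊥-elim (Q⇒¬R Qy Ry)
    ... | yes _  | yes _  | no _   = begin
      m y ∙ sumFilter P? xs                        ≈⟨ ∙-congˡ (go xs) ⟩
      m y ∙ (sumFilter Q? xs ∙ sumFilter R? xs)    ≈⟨ assoc _ _ _ ⟨
      (m y ∙ sumFilter Q? xs) ∙ sumFilter R? xs    ∎
    ... | yes _  | no _   | yes _  = begin
      m y ∙ sumFilter P? xs                        ≈⟨ ∙-congˡ (go xs) ⟩
      m y ∙ (sumFilter Q? xs ∙ sumFilter R? xs)    ≈⟨ x∙yz≈y∙xz _ _ _ ⟩
      sumFilter Q? xs ∙ (m y ∙ sumFilter R? xs)    ∎
    ... | yes Py | no ¬Qy | no ¬Ry with P⇒Q⊎R Py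
    ...   | inj₁ Qy = ⊥-elim (¬Qy Qy)
    ...   | inj₂ Ry = ⊥-elim (¬Ry Ry)
    go (y ∷ xs) | no ¬Py | yes Qy | _      = ⊥-elim (¬Py (Q⇒P Qy))
    go (y ∷ xs) | no ¬Py | no _   | yes Ry = ⊥-elim (¬Py (R⇒P Ry))
    go (y ∷ xs) | no _   | no _   | no _   = go xs

module FiniteLatticeProperties (L : FiniteLattice) where
  open FiniteLattice L
  open IsLattice isLattice
    renaming (refl to ≤-refl; trans to ≤-trans; antisym to ≤-antisym)

  lattice : Lattice 0ℓ 0ℓ 0ℓ
  lattice = record { isLattice = isLattice }

  open PosetProperties (Lattice.poset lattice) using (_<_; ≤-dec⇒≈-dec)
  open MeetSemilatticeProperties (Lattice.meetSemilattice lattice)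
    using (∧-comm; ∧-assoc; ∧-monotonic; y≤x⇒x∧y≈y)

  _≟_ : DecidableEquality Carrier
  _≟_ = ≤-dec⇒≈-dec _≤?_

  _<?_ : ∀ x y → Dec (x < y)
  x <? y = (x ≤? y) ×-dec ¬? (x ≟ y)

  #below : Carrier → ℕ
  #below t = length (filter (_≤? t) elements)

  #above : Carrier → ℕ
  #above c = length (filter (c ≤?_) elements)

  #below-mono-< : ∀ {y t} → y < t → #below y <ℕ #below t
  #below-mono-< {y} {t} (y≤t , y≢t) =
    length-filter-< (_≤? y) (_≤? t) (λ z≤y → ≤-trans z≤y y≤t) elements (complete t) ≤-refl
      (λ t≤y → y≢t (≤-antisym y≤t t≤y))

  #above-anti-< : ∀ {c z} → c < z → #above z <ℕ #above c
  #above-anti-< {c} {z} (c≤z , c≢z) =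
    length-filter-< (z ≤?_) (c ≤?_) (≤-trans c≤z) elements (complete c) ≤-refl
      (λ z≤c → c≢z (≤-antisym c≤z z≤c))

  <-wellFounded : WellFounded _<_
  <-wellFounded = Subrelation.wellFounded #below-mono-< (On.wellFounded #below ℕ.<-wellFounded)

  >-wellFounded : WellFounded (flip _<_)
  >-wellFounded = Subrelation.wellFounded #above-anti-< (On.wellFounded #above ℕ.<-wellFounded)

  x≤y⇒x∧y≡x : ∀ {x y} → x ≤ y → x ∧ y ≡ x
  x≤y⇒x∧y≡x {x} {y} x≤y = ≡.trans (∧-comm x y) (y≤x⇒x∧y≈y x≤y)

  ⋖⇒< : ∀ {x y} → x ⋖ y → x < y
  ⋖⇒< (x≤y , x≢y , _) = x≤y , x≢y

  ⋖-or-between : ∀ {c v} → c < v → c ⋖ v ⊎ Σ[ z ∈ Carrier ] c < z × z < v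
  ⋖-or-between {c} {v} (c≤v , c≢v) with any? (λ z → (c <? z) ×-dec (z <? v)) elements
  ... | yes between = inj₂ (satisfied between)
  ... | no ¬between = inj₁ (c≤v , c≢v , nothing-between)
    where
    nothing-between : ∀ z → c ≤ z → z ≤ v → z ≡ c ⊎ z ≡ v
    nothing-between z c≤z z≤v with z ≟ c | z ≟ v
    ... | yes z≡c | _       = inj₁ z≡c
    ... | no _    | yes z≡v = inj₂ z≡v
    ... | no z≢c  | no z≢v  =
      ⊥-elim (¬between (lose (complete z) ((c≤z , λ c≡z → z≢c (≡.sym c≡z)) , z≤v , z≢v)))

  ∃-lower-cover : ∀ {c v} → c < v → Σ[ d ∈ Carrier ] c ≤ d × d ⋖ v
  ∃-lower-cover {c} {v} = All.wfRec >-wellFounded 0ℓ LowerCoverAbove step c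
    where
    LowerCoverAbove : Pred Carrier 0ℓ
    LowerCoverAbove c = c < v → Σ[ d ∈ Carrier ] c ≤ d × d ⋖ v

    step : ∀ c → (∀ {z} → c < z → LowerCoverAbove z) → LowerCoverAbove c
    step c rec c<v with ⋖-or-between c<v
    ... | inj₁ c⋖v = c , ≤-refl , c⋖v
    ... | inj₂ (z , c<z , z<v) with rec c<z z<v
    ...   | d , z≤d , d⋖v = d , ≤-trans (proj₁ c<z) z≤d , d⋖v

  ⋖-between : ∀ {d e z} → d ⋖ e → d ≤ z → z < e → z ≡ d
  ⋖-between (_ , _ , cover) d≤z (z≤e , z≢e) with cover _ d≤z z≤e
  ... | inj₁ z≡d = z≡d
  ... | inj₂ z≡e = ⊥-elim (z≢e z≡e)

  distinct-lower-covers-join : ∀ {p q t} → p ⋖ t → q ⋖ t → p ≢ q → p ∨ q ≡ t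
  distinct-lower-covers-join {p} {q} (p≤t , p≢t , p-cover) q⋖t p≢q
    with p-cover (p ∨ q) (x≤x∨y p q) (∨-least p≤t (proj₁ q⋖t))
  ... | inj₂ p∨q≡t = p∨q≡t
  ... | inj₁ p∨q≡p = ⊥-elim (p≢q (⋖-between q⋖t q≤p (p≤t , p≢t)))
    where
    q≤p : q ≤ p
    q≤p = subst (q ≤_) p∨q≡p (y≤x∨y p q)

  ⋖-join⇒≰ : ∀ {x i} → x ⋖ (x ∨ i) → ¬ i ≤ x
  ⋖-join⇒≰ {x} {i} (_ , x≢x∨i , _) i≤x = x≢x∨i (≤-antisym (x≤x∨y x i) (∨-least ≤-refl i≤x))

  module _ (lowerSemimodular : LowerSemimodular) where

    meet-of-distinct-lower-covers : ∀ {p q t} → p ⋖ t → q ⋖ t → p ≢ q →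
                                    ((p ∧ q) ⋖ p) × ((p ∧ q) ⋖ q)
    meet-of-distinct-lower-covers {p} {q} {t} p⋖t q⋖t p≢q =
      lowerSemimodular p q (subst (p ⋖_) t≡p∨q p⋖t) (subst (q ⋖_) t≡p∨q q⋖t)
      where
      t≡p∨q : t ≡ p ∨ q
      t≡p∨q = ≡.sym (distinct-lower-covers-join p⋖t q⋖t p≢q)

    ∧-⋖-of-⋖ : ∀ {x t w} → x ⋖ t → w ≤ t → ¬ w ≤ x → (x ∧ w) ⋖ w
    ∧-⋖-of-⋖ {x} {t} {w} = All.wfRec <-wellFounded 0ℓ Claim step t x w
      where
      Claim : Pred Carrier 0ℓ
      Claim t = ∀ x w → x ⋖ t → w ≤ t → ¬ w ≤ x → (x ∧ w) ⋖ w

      step : ∀ t → (∀ {y} → y < t → Claim y) → Claim t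
      step t rec x w x⋖t w≤t w≰x with w ≟ t
      ... | yes refl = subst (_⋖ t) (≡.sym (x≤y⇒x∧y≡x (proj₁ x⋖t))) x⋖t
      ... | no w≢t with ∃-lower-cover (w≤t , w≢t)
      ...   | y , w≤y , y⋖t = subst (_⋖ w) x∧y∧w≡x∧w
                (rec (⋖⇒< y⋖t) (x ∧ y) w x∧y⋖y w≤y (λ w≤x∧y → w≰x (≤-trans w≤x∧y (x∧y≤x x y))))
        where
        x∧y⋖y : (x ∧ y) ⋖ y
        x∧y⋖y = proj₂ (meet-of-distinct-lower-covers x⋖t y⋖t
                  (λ x≡y → w≰x (subst (w ≤_) (≡.sym x≡y) w≤y)))

        x∧y∧w≡x∧w : (x ∧ y) ∧ w ≡ x ∧ w
        x∧y∧w≡x∧w = ≡.trans (∧-assoc x y w) (cong (x ∧_) (y≤x⇒x∧y≈y w≤y))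

    three-lower-covers-M₃ : ∀ {x y z t} → x ⋖ t → y ⋖ t → z ⋖ t →
                            x ≢ y → x ≢ z → y ≢ z → y ∧ z ≤ x → IsM₃ (y ∧ z) x y z t
    three-lower-covers-M₃ {x} {y} {z} {t} x⋖t y⋖t z⋖t x≢y x≢z y≢z o≤x =
      o≢x , proj₁ (proj₂ o⋖y) , proj₁ (proj₂ o⋖z) , o≢t ,
      x≢y , x≢z , proj₁ (proj₂ x⋖t) , y≢z , proj₁ (proj₂ y⋖t) , proj₁ (proj₂ z⋖t) ,
      x∧y≡o , x∧z≡o , refl ,
      distinct-lower-covers-join x⋖t y⋖t x≢y ,
      distinct-lower-covers-join x⋖t z⋖t x≢z ,
      distinct-lower-covers-join y⋖t z⋖t y≢z
      where
      o : Carrier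
      o = y ∧ z

      o⋖y : o ⋖ y
      o⋖y = proj₁ (meet-of-distinct-lower-covers y⋖t z⋖t y≢z)

      o⋖z : o ⋖ z
      o⋖z = proj₂ (meet-of-distinct-lower-covers y⋖t z⋖t y≢z)

      x∧y⋖ : ((x ∧ y) ⋖ x) × ((x ∧ y) ⋖ y)
      x∧y⋖ = meet-of-distinct-lower-covers x⋖t y⋖t x≢y

      x∧z⋖ : ((x ∧ z) ⋖ x) × ((x ∧ z) ⋖ z)
      x∧z⋖ = meet-of-distinct-lower-covers x⋖t z⋖t x≢z

      x∧y≡o : x ∧ y ≡ o
      x∧y≡o = ⋖-between o⋖y (∧-greatest o≤x (x∧y≤x y z)) (⋖⇒< (proj₂ x∧y⋖))

      x∧z≡o : x ∧ z ≡ o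
      x∧z≡o = ⋖-between o⋖z (∧-greatest o≤x (x∧y≤y y z)) (⋖⇒< (proj₂ x∧z⋖))

      o≢x : o ≢ x
      o≢x o≡x = proj₁ (proj₂ (proj₁ x∧y⋖)) (≡.trans x∧y≡o o≡x)

      o≢t : o ≢ t
      o≢t o≡t = proj₁ (proj₂ x⋖t) (≤-antisym (proj₁ x⋖t) (subst (_≤ x) o≡t o≤x))

    module _ (noM₃ : HasNoM₃) where

      ∧-closed-outside-lower-cover : ∀ {x t a b} → x ⋖ t → a ≤ t → b ≤ t →
                                     ¬ a ≤ x → ¬ b ≤ x → ¬ a ∧ b ≤ x
      ∧-closed-outside-lower-cover {x} {t} {a} {b} = All.wfRec <-wellFounded 0ℓ Claim step t x a b
        where
        Claim : Pred Carrier 0ℓ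
        Claim t = ∀ x a b → x ⋖ t → a ≤ t → b ≤ t → ¬ a ≤ x → ¬ b ≤ x → ¬ a ∧ b ≤ x

        -- y is any lower cover of t above a; the induction hypothesis at y, applied to its
        -- lower cover x ∧ y, forces y ∧ b ≤ x.
        lower-cover-outside : ∀ {t x a b} → (∀ {y} → y < t → Claim y) → x ⋖ t →
                              a < t → ¬ a ≤ x → a ∧ b ≤ x →
                              Σ[ y ∈ Carrier ] y ⋖ t × ¬ y ≤ x × y ∧ b ≤ x
        lower-cover-outside {t} {x} {a} {b} rec x⋖t a<t a≰x a∧b≤x with ∃-lower-cover a<t
        ... | y , a≤y , y⋖t with (y ∧ b) ≤? x
        ...   | yes y∧b≤x = y , y⋖t , (λ y≤x → a≰x (≤-trans a≤y y≤x)) , y∧b≤x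
        ...   | no y∧b≰x = ⊥-elim (rec (⋖⇒< y⋖t) (x ∧ y) a (y ∧ b) x∧y⋖y a≤y (x∧y≤x y b)
                                     (≰x⇒≰x∧y a≰x) (≰x⇒≰x∧y y∧b≰x) a∧y∧b≤x∧y)
          where
          ≰x⇒≰x∧y : ∀ {z} → ¬ z ≤ x → ¬ z ≤ x ∧ y
          ≰x⇒≰x∧y z≰x z≤x∧y = z≰x (≤-trans z≤x∧y (x∧y≤x x y))

          x∧y⋖y : (x ∧ y) ⋖ y
          x∧y⋖y = proj₂ (meet-of-distinct-lower-covers x⋖t y⋖t
                    (λ x≡y → a≰x (subst (a ≤_) (≡.sym x≡y) a≤y)))

          a∧y∧b≤x∧y : a ∧ (y ∧ b) ≤ x ∧ y
          a∧y∧b≤x∧y = ∧-greatest (≤-trans (∧-monotonic ≤-refl (x∧y≤y y b)) a∧b≤x)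
                                 (≤-trans (x∧y≤y a (y ∧ b)) (x∧y≤x y b))

        step : ∀ t → (∀ {y} → y < t → Claim y) → Claim t
        step t rec x a b x⋖t a≤t b≤t a≰x b≰x a∧b≤x with a ≟ t
        ... | yes refl = b≰x (≤-trans (∧-greatest b≤t ≤-refl) a∧b≤x)
        ... | no a≢t with lower-cover-outside rec x⋖t (a≤t , a≢t) a≰x a∧b≤x
        ...   | y , y⋖t , y≰x , y∧b≤x with b ≟ t
        ...     | yes refl = y≰x (≤-trans (∧-greatest ≤-refl (proj₁ y⋖t)) y∧b≤x)
        ...     | no b≢t with lower-cover-outside rec x⋖t (b≤t , b≢t) b≰x
                                (subst (_≤ x) (∧-comm y b) y∧b≤x)
        ...       | y′ , y′⋖t , y′≰x , y′∧y≤x =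
                    noM₃ _ _ _ _ _ (three-lower-covers-M₃ x⋖t y′⋖t y⋖t x≢y′ x≢y y′≢y y′∧y≤x)
          where
          x≢y′ : x ≢ y′
          x≢y′ x≡y′ = y′≰x (subst (_≤ x) x≡y′ ≤-refl)

          x≢y : x ≢ y
          x≢y x≡y = y≰x (subst (_≤ x) x≡y ≤-refl)

          y′≢y : y′ ≢ y
          y′≢y y′≡y = y≰x (≤-trans (∧-greatest (subst (y ≤_) (≡.sym y′≡y) ≤-refl) ≤-refl) y′∧y≤x)

      join-irreducible-≤-of-≰ : ∀ {x i y} → JoinIrreducible i → x ⋖ (x ∨ i) →
                                y ≤ x ∨ i → ¬ y ≤ x → i ≤ y
      join-irreducible-≤-of-≰ {x} {i} {y} (_ , unique-lower-cover) x⋖x∨i y≤x∨i y≰x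
        with (y ∧ i) ≟ i
      ... | yes y∧i≡i = subst (_≤ y) y∧i≡i (x∧y≤x y i)
      ... | no y∧i≢i with ∃-lower-cover (x∧y≤y y i , y∧i≢i)
      ...   | d , y∧i≤d , d⋖i =
              ⊥-elim (∧-closed-outside-lower-cover x⋖x∨i y≤x∨i (y≤x∨y x i) y≰x i≰x y∧i≤x)
        where
        i≰x : ¬ i ≤ x
        i≰x = ⋖-join⇒≰ x⋖x∨i

        d≡x∧i : d ≡ x ∧ i
        d≡x∧i = unique-lower-cover d (x ∧ i) d⋖i (∧-⋖-of-⋖ x⋖x∨i (y≤x∨y x i) i≰x)

        y∧i≤x : y ∧ i ≤ x
        y∧i≤x = ≤-trans y∧i≤d (subst (_≤ x) (≡.sym d≡x∧i) (x∧y≤x x i))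

proposition1 : {c ℓ : Level} (L : FiniteLattice) (G : AbelianGroup c ℓ) →
    FiniteLattice.LowerLocallyDistributive L →
    (f m : FiniteLattice.Carrier L → AbelianGroup.Carrier G) →
    IsMobiusTransform L G f m →
    (x i : FiniteLattice.Carrier L) →
    FiniteLattice.JoinIrreducible L i →
    FiniteLattice._⋖_ L x (FiniteLattice._∨_ L x i) →
    AbelianGroup._≈_ G (Δ L G f i x)
    (sumInterval L G m i (FiniteLattice._∨_ L x i))
proposition1 L G (lowerSemimodular , noM₃) f m mobius x i i-irreducible x⋖x∨i = begin
  f (x ∨ i) ∙ f x ⁻¹                           ≈⟨ ∙-cong (mobius (x ∨ i)) (⁻¹-cong (mobius x)) ⟩
  sumBelow L G m (x ∨ i) ∙ Σ↓x ⁻¹              ≈⟨ ∙-congʳ Σ↓x∨i≈Σ↓x∙Σ[i,x∨i] ⟩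
  (Σ↓x ∙ sumInterval L G m i (x ∨ i)) ∙ Σ↓x ⁻¹ ≈⟨ xyx⁻¹≈y Σ↓x _ ⟩
  sumInterval L G m i (x ∨ i)                  ∎
  where
  open FiniteLattice L using (_≤_; _≤?_; _∨_; isLattice; elements)
  open IsLattice isLattice using (x≤x∨y) renaming (trans to ≤-trans)
  open FiniteLatticeProperties L
  open AbelianGroup G using (Carrier; _≈_; _∙_; _⁻¹; ∙-cong; ∙-congʳ; ⁻¹-cong; setoid; commutativeMonoid)
  open AbelianGroupProperties G using (xyx⁻¹≈y)
  open ≈-Reasoning setoid

  Σ↓x : Carrier
  Σ↓x = sumBelow L G m x

  Σ↓x∨i≈Σ↓x∙Σ[i,x∨i] : sumBelow L G m (x ∨ i) ≈ Σ↓x ∙ sumInterval L G m i (x ∨ i)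
  Σ↓x∨i≈Σ↓x∙Σ[i,x∨i] = sumFilter-⊎ commutativeMonoid m
    (_≤? (x ∨ i)) (_≤? x) (λ y → (i ≤? y) ×-dec (y ≤? (x ∨ i)))
    below-x-or-above-i (λ y≤x → ≤-trans y≤x (x≤x∨y x i)) proj₂
    (λ y≤x (i≤y , _) → ⋖-join⇒≰ x⋖x∨i (≤-trans i≤y y≤x)) elements
    where
    below-x-or-above-i : ∀ {y} → y ≤ x ∨ i → y ≤ x ⊎ (i ≤ y × y ≤ x ∨ i)
    below-x-or-above-i {y} y≤x∨i with y ≤? x
    ... | yes y≤x = inj₁ y≤x
    ... | no y≰x = inj₂ (join-irreducible-≤-of-≰ lowerSemimodular noM₃ i-irreducible x⋖x∨i y≤x∨i y≰x
                         , y≤x∨i)
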